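{- Let $C>0$ and consider the discrete $k$-wallet model with $k=1$ and maximum transaction size $T=C$ (so $r=kT/C=1$). Then there is no deterministic online $1$-wallet settlement algorithm that is $\alpha$-competitive for any finite $\alpha$.
   Context: Discrete $k$-wallet model $\mathcal{M}^{C,k}_T$: Time is divided into discrete slots $t=1,2,\dots$. A transaction sequence is $\mathsf{Tx}=(\mathsf{tx}_1,\dots,\mathsf{tx}_n)$, where $\mathsf{tx}_t\in[0,T]$ is the value of the transaction arriving at slot $t$ (value $0$ means no transaction). A total collateral $C$ is divided into $k$ wallets, each of capacity $C/k$. Each wallet is either online with some available (uncommitted) collateral $R\in[0,C/k]$, or offline. When a transaction of value $v$ arrives, the policy must immediately either settle it, using an online wallet with $R\ge v$ (whose available collateral becomes $R-v$), or discard it. At any time $t$ the policy may flush a wallet; the wallet is then offline during the slots of the interval $(t,t+F]$ (with $F$ a fixed positive integer flush period), after which it is online again with available collateral reset to $C/k$. For a policy $\mathrm{A}$, $V_{\mathrm{A}}(\mathsf{Tx})$ denotes the total value of transactions it settles. An algorithm is online if its decisions at time $N$ depend only on $\mathsf{tx}_1,\dots,\mathsf{tx}_N$. $\mathrm{OPT}$ denotes an optimal offline $k$-wallet policy, i.e. $V_{\mathrm{OPT}}(\mathsf{Tx})$ is the maximum settled value achievable by any $k$-wallet policy with full knowledge of $\mathsf{Tx}$. An algorithm $\mathrm{A}$ is $\alpha$-competitive in this model if for every sequence $\mathsf{Tx}$ with values at most $T$, $V_{\mathrm{OPT}}(\mathsf{Tx})\le \alpha V_{\mathrm{A}}(\mathsf{Tx})+O(1)$,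 where the $O(1)$ constant may depend on $C,k,T$ (and $F$) but not on $\mathsf{Tx}$ or its length.
   Formalization: The collateral $C$, the ratio $\alpha$ and the additive $O(1)$ constant range over the rationals, and the transaction values are taken in the rationals as well. -}

module Defs where

open import Data.Bool using (Bool; true; false; if_then_else_)
open import Data.Nat as ℕ using (ℕ; zero; suc)
open import Data.Product using (_×_; _,_; Σ-syntax)
open import Data.List using (List; []; _∷_; [_]; map; foldr; _++_)
open import Data.List.Relation.Unary.All using (All)
open import Data.Rational using (ℚ; 0ℚ; _≤_; _+_; _-_; _*_; _⊔_; _≤ᵇ_)

-- Discrete k-wallet model with k = 1: one wallet of capacity C (= C/k).
-- Wallet state at the END of a slot:
--   online R    : online with available collateral R
--   offline j   : offline for j more slots (j ≥ 1); after j more slots it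
--                 is online again with collateral reset to C.
data WState : Set where
  online  : ℚ → WState
  offline : ℕ → WState

-- A decision for one slot: (settle the arriving transaction?, flush after it?)
Decision : Set
Decision = Bool × Bool

-- Settling is only effective if the wallet is online with R ≥ v;
-- flushing at slot t makes the wallet offline in slots t+1 … t+F
-- (flushing an offline wallet has no effect).
step : ℚ → ℕ → WState → Decision → ℚ → WState × ℚ
step C F (offline zero)          d v = online C , 0ℚ   -- (not reachable)
step C F (offline (suc zero))    d v = online C , 0ℚ
step C F (offline (suc (suc j))) d v = offline (suc j) , 0ℚ
step C F (online R) (s , f) v =
  let ok  = if s then v ≤ᵇ R else false
      R'  = if ok then R - v else R
      g   = if ok then v else 0ℚ
  in (if f then offline F else online R') , g

runFrom : ℚ → ℕ → WState → List Decision → List ℚ → ℚ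
runFrom C F w (d ∷ ds) (v ∷ vs) with step C F w d v
... | w' , g = g + runFrom C F w' ds vs
runFrom C F w _ _ = 0ℚ

runSched : ℚ → ℕ → List Decision → List ℚ → ℚ
runSched C F ds tx = runFrom C F (online C) ds tx

-- Deterministic online policy: the decision at slot N is a function of
-- the prefix tx_1 … tx_N (the wallet state is itself determined by it).
Policy : Set
Policy = List ℚ → Decision

prefixes : List ℚ → List (List ℚ)
prefixes []       = []
prefixes (x ∷ xs) = [ x ] ∷ map (x ∷_) (prefixes xs)

V : ℚ → ℕ → Policy → List ℚ → ℚ
V C F A tx = runSched C F (map A (prefixes tx)) tx

allScheds : ℕ → List (List Decision)
allScheds zero    = [] ∷ []
allScheds (suc n) = foldr (λ d acc → map (d ∷_) (allScheds n) ++ acc) []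
                      ((false , false) ∷ (false , true) ∷ (true , false) ∷ (true , true) ∷ [])

len : List ℚ → ℕ
len []       = zero
len (_ ∷ xs) = suc (len xs)

VOPT : ℚ → ℕ → List ℚ → ℚ
VOPT C F tx = foldr (λ ds m → runSched C F ds tx ⊔ m) 0ℚ (allScheds (len tx))

ValidTx : ℚ → List ℚ → Set
ValidTx T tx = All (λ v → (0ℚ ≤ v) × (v ≤ T)) tx

Competitive : ℚ → ℚ → ℕ → Policy → ℚ → Set
Competitive C T F A α =
  Σ[ c ∈ ℚ ] (∀ tx → ValidTx T tx → VOPT C F tx ≤ α * V C F A tx + c)

{-# OPTIONS --safe #-}
-- The adversary sends a small ε while the wallet is online with its full collateral C, and C
-- otherwise. A wallet that is not full can never settle C, and once it settles an ε it is no
-- longer full, so it settles nothing more until it is flushed and reset. With potential C − ε on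
-- a full wallet and 0 elsewhere, each slot satisfies
--   ε + a·(value settled) + potential after ≤ value sent + potential before
-- as soon as ε(1 + a) ≤ C, hence n slots give  n ε + a V_A ≤ Σ tx + C − ε.  Offline, the F + 1
-- schedules that idle for d slots and then settle and flush in every slot settle every
-- transaction between them, so Σ tx ≤ (F + 1) V_OPT. With a = (F + 1) α, competitiveness gives
-- n ε ≤ (F + 1) c + C − ε for every n, contradicting the Archimedean property.
module Submission where

open import Defs
open import Data.Nat using (ℕ; _≥_)
open import Data.Rational using (ℚ; 0ℚ; _<_)
open import Relation.Nullary using (¬_)

open import Algebra.Bundles using (CommutativeRing)
open import Data.Bool using (Bool; true; false; if_then_else_)
open import Data.Bool.Properties using (¬-not; T-≡)
open import Data.Integer as ℤ using (-[1+_])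
import Data.Integer.Properties as ℤ
open import Data.List using (List; []; _∷_; [_]; map; foldr; drop)
open import Data.List.Properties using (map-∘)
open import Data.List.Membership.Propositional using (_∈_)
open import Data.List.Membership.Propositional.Properties using (∈-map⁺; ∈-++⁺ˡ; ∈-++⁺ʳ)
open import Data.List.Relation.Unary.All as All using (All; []; _∷_)
open import Data.List.Relation.Unary.Any using (here; there)
open import Data.Nat as ℕ using (zero; suc)
import Data.Nat.Properties as ℕ
open import Data.Product as Prod using (∃; _,_; proj₁; proj₂)
open import Data.Rational hiding (_≥_; truncate)
open import Data.Rational.Properties
open import Data.Rational.Solver using (module +-*-Solver)
import Data.Rational.Unnormalised as ℚᵘ
import Data.Rational.Unnormalised.Properties as ℚᵘ
open import Data.Unit using (⊤; tt)
open import Function using (_∘_; Equivalence)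
open import Relation.Binary.PropositionalEquality hiding ([_])

open import Algebra.Definitions.RawMonoid +-0-rawMonoid using (_×_)
open import Algebra.Properties.CommutativeMonoid.Mult +-0-commutativeMonoid using (×-distrib-+)
open import Algebra.Properties.Semiring.Mult (CommutativeRing.semiring +-*-commutativeRing)
  using (×-assoc-*)
open +-*-Solver using (solve; _:=_; _:+_; _:*_; _:-_; con)

×-monoʳ-≤ : ∀ n {p q} → p ≤ q → n × p ≤ n × q
×-monoʳ-≤ zero    p≤q = ≤-refl
×-monoʳ-≤ (suc n) p≤q = +-mono-≤ p≤q (×-monoʳ-≤ n p≤q)

toℚᵘ-×-1ℚ : ∀ n → toℚᵘ (n × 1ℚ) ℚᵘ.≃ ℤ.+ n ℚᵘ./ 1
toℚᵘ-×-1ℚ zero    = ℚᵘ.≃-refl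
toℚᵘ-×-1ℚ (suc n) = ℚᵘ.≃-trans (toℚᵘ-homo-+ 1ℚ (n × 1ℚ))
  (ℚᵘ.≃-trans (ℚᵘ.+-congʳ ℚᵘ.1ℚᵘ (toℚᵘ-×-1ℚ n))
    (ℚᵘ.*≡* (trans (ℤ.*-identityʳ _)
      (trans (cong (ℤ._+_ ℤ.1ℤ) (ℤ.*-identityʳ (ℤ.+ n))) (sym (ℤ.*-identityʳ _))))))

archimedean-1ℚ : ∀ p → ∃ λ n → p < n × 1ℚ
archimedean-1ℚ (mkℚ (ℤ.+ m) d _) = suc m , toℚᵘ-cancel-< (ℚᵘ.<-respʳ-≃ (ℚᵘ.≃-sym (toℚᵘ-×-1ℚ (suc m)))
  (ℚᵘ.*<* (subst₂ ℤ._<_ (ℤ.pos-* m 1) (ℤ.pos-* (suc m) (suc d)) (ℤ.+<+ m*1<[1+m]*[1+d]))))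
  where
  m*1<[1+m]*[1+d] : m ℕ.* 1 ℕ.< suc m ℕ.* suc d
  m*1<[1+m]*[1+d] = ℕ.≤-trans (ℕ.s≤s (ℕ.≤-reflexive (ℕ.*-identityʳ m))) (ℕ.m≤m*n (suc m) (suc d))
archimedean-1ℚ (mkℚ -[1+ m ] d _) = 1 , toℚᵘ-cancel-< (ℚᵘ.<-respʳ-≃ (ℚᵘ.≃-sym (toℚᵘ-×-1ℚ 1)) (ℚᵘ.*<* ℤ.-<+))

archimedean : ∀ ε .{{_ : Positive ε}} p → ∃ λ n → p < n × ε
archimedean ε p = let n , lt = archimedean-1ℚ (p * 1/ ε) in n , scale n lt
  where
  open ≤-Reasoning
  instance
    ε≢0 : NonZero ε
    ε≢0 = pos⇒nonZero ε
  scale : ∀ n → p * 1/ ε < n × 1ℚ → p < n × ε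
  scale n lt = begin-strict
    p                ≡⟨ sym (trans (*-assoc p (1/ ε) ε) (trans (cong (p *_) (*-inverseˡ ε)) (*-identityʳ p))) ⟩
    p * 1/ ε * ε     <⟨ *-monoˡ-<-pos ε lt ⟩
    n × 1ℚ * ε       ≡⟨ ×-assoc-* n 1ℚ ε ⟩
    n × (1ℚ * ε)     ≡⟨ cong (n ×_) (*-identityˡ ε) ⟩
    n × ε            ∎

+-cancelʳ-≤ : ∀ r {p q} → p + r ≤ q + r → p ≤ q
+-cancelʳ-≤ r {p} {q} p+r≤q+r = subst₂ _≤_ (+-r p) (+-r q) (+-monoˡ-≤ (- r) p+r≤q+r)
  where
  +-r : ∀ x → x + r - r ≡ x
  +-r x = trans (+-assoc x r (- r)) (trans (cong (x +_) (+-inverseʳ r)) (+-identityʳ x))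

p-q<p : ∀ p {q} → 0ℚ < q → p - q < p
p-q<p p 0<q = subst (p - _ <_) (+-identityʳ p) (+-monoʳ-< p (neg-antimono-< 0<q))

<⇒≤ᵇ≡false : ∀ {p q} → p < q → (q ≤ᵇ p) ≡ false
<⇒≤ᵇ≡false p<q = ¬-not λ q≤ᵇp → <-irrefl refl (<-≤-trans p<q (≤ᵇ⇒≤ (Equivalence.from T-≡ q≤ᵇp)))

≤-foldr-⊔ : ∀ {A : Set} (f : A → ℚ) {x xs} → x ∈ xs → f x ≤ foldr (λ y m → f y ⊔ m) 0ℚ xs
≤-foldr-⊔ f {xs = y ∷ _} (here refl) = p≤p⊔q (f y) _
≤-foldr-⊔ f {xs = y ∷ _} (there x∈xs) = ≤-trans (≤-foldr-⊔ f x∈xs) (p≤q⊔p (f y) _)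

sumℚ : List ℚ → ℚ
sumℚ = foldr _+_ 0ℚ

runPolicy : ℚ → ℕ → Policy → WState → List ℚ → ℚ
runPolicy C F B w tx = runFrom C F w (map B (prefixes tx)) tx

runPolicy-∷ : ∀ C F B w v tx → let (w′ , g) = step C F w (B [ v ]) v in
              runPolicy C F B w (v ∷ tx) ≡ g + runPolicy C F (B ∘ (v ∷_)) w′ tx
runPolicy-∷ C F B w v tx =
  cong (λ ds → proj₂ (step C F w (B [ v ]) v) + runFrom C F _ ds tx) (sym (map-∘ (prefixes tx)))

module SettleAndFlush (C : ℚ) (F′ : ℕ) where

  F : ℕ
  F = suc F′

  idleThenSettleFlush : ℕ → List ℚ → List Decision
  idleThenSettleFlush _       []       = []
  idleThenSettleFlush zero    (_ ∷ tx) = (true , true) ∷ idleThenSettleFlush zero tx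
  idleThenSettleFlush (suc d) (_ ∷ tx) = (false , false) ∷ idleThenSettleFlush d tx

  settleFlushFrom : WState → List ℚ → ℚ
  settleFlushFrom w tx = runFrom C F w (idleThenSettleFlush zero tx) tx

  shiftedTotal : ℕ → List ℚ → ℚ
  shiftedTotal zero    tx = 0ℚ
  shiftedTotal (suc d) tx = settleFlushFrom (online C) (drop d tx) + shiftedTotal d tx

  runSched-idleThenSettleFlush : ∀ d tx →
    runSched C F (idleThenSettleFlush d tx) tx ≡ settleFlushFrom (online C) (drop d tx)
  runSched-idleThenSettleFlush zero    tx       = refl
  runSched-idleThenSettleFlush (suc d) []       = refl
  runSched-idleThenSettleFlush (suc d) (_ ∷ tx) = trans (+-identityˡ _) (runSched-idleThenSettleFlush d tx)

  settleFlushFrom-offline : ∀ j tx →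
    settleFlushFrom (offline (suc j)) tx ≡ settleFlushFrom (online C) (drop (suc j) tx)
  settleFlushFrom-offline j       []       = refl
  settleFlushFrom-offline zero    (_ ∷ tx) = +-identityˡ _
  settleFlushFrom-offline (suc j) (_ ∷ tx) = trans (+-identityˡ _) (settleFlushFrom-offline j tx)

  settleFlushFrom-∷ : ∀ {x} tx → x ≤ C →
    settleFlushFrom (online C) (x ∷ tx) ≡ x + settleFlushFrom (online C) (drop F tx)
  settleFlushFrom-∷ {x} tx x≤C with x ≤ᵇ C | Equivalence.to T-≡ (≤⇒≤ᵇ x≤C)
  ... | true | _ = cong (x +_) (settleFlushFrom-offline F′ tx)

  shiftedTotal-[] : ∀ d → shiftedTotal d [] ≡ 0ℚ
  shiftedTotal-[] zero          = refl
  shiftedTotal-[] (suc zero)    = +-identityˡ 0ℚ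
  shiftedTotal-[] (suc (suc d)) = trans (+-identityˡ _) (shiftedTotal-[] (suc d))

  shiftedTotal-∷ : ∀ d x tx →
    shiftedTotal (suc d) (x ∷ tx) ≡ settleFlushFrom (online C) (x ∷ tx) + shiftedTotal d tx
  shiftedTotal-∷ zero    x tx = refl
  shiftedTotal-∷ (suc d) x tx = trans (cong (settleFlushFrom (online C) (drop d tx) +_) (shiftedTotal-∷ d x tx))
    (solve 3 (λ a b c → a :+ (b :+ c) := b :+ (a :+ c)) refl
      (settleFlushFrom (online C) (drop d tx)) (settleFlushFrom (online C) (x ∷ tx)) (shiftedTotal d tx))

  -- The F + 1 shifted schedules settle every transaction exactly once.
  -- Schedule d settles exactly the slots t ≡ d (mod F + 1): each x ≤ C fits the reset wallet.
  shiftedTotal-period : ∀ {tx} → All (_≤ C) tx → shiftedTotal (suc F) tx ≡ sumℚ tx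
  shiftedTotal-period {[]}     []           = shiftedTotal-[] (suc F)
  shiftedTotal-period {x ∷ tx} (x≤C ∷ tx≤C) = begin
    shiftedTotal (suc F) (x ∷ tx)                                         ≡⟨ shiftedTotal-∷ F x tx ⟩
    settleFlushFrom (online C) (x ∷ tx) + shiftedTotal F tx               ≡⟨ cong (_+ shiftedTotal F tx) (settleFlushFrom-∷ tx x≤C) ⟩
    x + settleFlushFrom (online C) (drop F tx) + shiftedTotal F tx       ≡⟨ +-assoc x _ _ ⟩
    x + shiftedTotal (suc F) tx                                           ≡⟨ cong (x +_) (shiftedTotal-period tx≤C) ⟩
    sumℚ (x ∷ tx)                                                         ∎
    where open ≡-Reasoning

  idleThenSettleFlush-∈ : ∀ d tx → idleThenSettleFlush d tx ∈ allScheds (len tx)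
  idleThenSettleFlush-∈ d       []       = here refl
  idleThenSettleFlush-∈ zero    (_ ∷ tx) =
    ∈-++⁺ʳ (map ((false , false) ∷_) S) (∈-++⁺ʳ (map ((false , true) ∷_) S)
      (∈-++⁺ʳ (map ((true , false) ∷_) S) (∈-++⁺ˡ (∈-map⁺ ((true , true) ∷_) (idleThenSettleFlush-∈ zero tx)))))
    where S = allScheds (len tx)
  idleThenSettleFlush-∈ (suc d) (_ ∷ tx) = ∈-++⁺ˡ (∈-map⁺ ((false , false) ∷_) (idleThenSettleFlush-∈ d tx))

  settleFlushFrom-≤-VOPT : ∀ d tx → settleFlushFrom (online C) (drop d tx) ≤ VOPT C F tx
  settleFlushFrom-≤-VOPT d tx = subst (_≤ VOPT C F tx) (runSched-idleThenSettleFlush d tx)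
    (≤-foldr-⊔ (λ ds → runSched C F ds tx) (idleThenSettleFlush-∈ d tx))

  shiftedTotal-≤ : ∀ m tx → shiftedTotal m tx ≤ m × VOPT C F tx
  shiftedTotal-≤ zero    tx = ≤-refl
  shiftedTotal-≤ (suc m) tx = +-mono-≤ (settleFlushFrom-≤-VOPT m tx) (shiftedTotal-≤ m tx)

  sumℚ-≤-VOPT : ∀ {tx} → All (_≤ C) tx → sumℚ tx ≤ suc F × VOPT C F tx
  sumℚ-≤-VOPT {tx} tx≤C = subst (_≤ suc F × VOPT C F tx) (shiftedTotal-period tx≤C) (shiftedTotal-≤ (suc F) tx)

module Adversary (C ε a : ℚ) (F : ℕ) (0<ε : 0ℚ < ε) (ε≤C : ε ≤ C) (ε+aε≤C : ε + a * ε ≤ C) where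

  full : WState → Bool
  full (online R)  = C ≤ᵇ R
  full (offline _) = false

  nextTx : WState → ℚ
  nextTx w = if full w then ε else C

  potential : WState → ℚ
  potential w = if full w then C - ε else 0ℚ

  Bounded : WState → Set
  Bounded (online R)  = R ≤ C
  Bounded (offline _) = ⊤

  data SlotOutcome : WState Prod.× ℚ → Set where
    unsettled : ∀ {w} → SlotOutcome (w , 0ℚ)
    settled   : ∀ {w} → full w ≡ false → SlotOutcome (w , ε)

  ε+[C-ε]≡C : ε + (C - ε) ≡ C
  ε+[C-ε]≡C = solve 2 (λ e c → e :+ (c :- e) := c) refl ε C

  0≤C-ε : 0ℚ ≤ C - ε
  0≤C-ε = subst (_≤ C - ε) (+-inverseʳ ε) (+-monoˡ-≤ (- ε) ε≤C)

  potential≤C-ε : ∀ w → potential w ≤ C - ε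
  potential≤C-ε w with full w
  ... | true  = ≤-refl
  ... | false = 0≤C-ε

  0≤potential : ∀ w → 0ℚ ≤ potential w
  0≤potential w with full w
  ... | true  = 0≤C-ε
  ... | false = ≤-refl

  nextTx+potential≡C : ∀ w → nextTx w + potential w ≡ C
  nextTx+potential≡C w with full w
  ... | true  = ε+[C-ε]≡C
  ... | false = +-identityʳ C

  0<nextTx : ∀ w → 0ℚ < nextTx w
  0<nextTx w with full w
  ... | true  = 0<ε
  ... | false = <-≤-trans 0<ε ε≤C

  nextTx≤C : ∀ w → nextTx w ≤ C
  nextTx≤C w with full w
  ... | true  = ε≤C
  ... | false = ≤-refl

  step-bounded : ∀ w d {v} → 0ℚ < v → Bounded w → Bounded (proj₁ (step C F w d v))
  step-bounded (offline zero)          _               _   _   = ≤-refl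
  step-bounded (offline (suc zero))    _               _   _   = ≤-refl
  step-bounded (offline (suc (suc _))) _               _   _   = tt
  step-bounded (online R)              (_     , true)  _   _   = tt
  step-bounded (online R)              (false , false) _   R≤C = R≤C
  step-bounded (online R)              (true  , false) {v} 0<v R≤C with v ≤ᵇ R
  ... | true  = ≤-trans (<⇒≤ (p-q<p R 0<v)) R≤C
  ... | false = R≤C

  full-after-settling : ∀ f {R} → R ≤ C → full (if f then offline F else online (R - ε)) ≡ false
  full-after-settling true  _   = refl
  full-after-settling false R≤C = <⇒≤ᵇ≡false (<-≤-trans (p-q<p _ 0<ε) R≤C)

  step-outcome : ∀ w d → Bounded w → SlotOutcome (step C F w d (nextTx w))
  step-outcome (offline zero)          _           _ = unsettled
  step-outcome (offline (suc zero))    _           _ = unsettled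
  step-outcome (offline (suc (suc _))) _           _ = unsettled
  step-outcome (online R)              (false , _) _ = unsettled
  step-outcome (online R)              (true  , f) R≤C with C ≤ᵇ R in R-full
  ... | false rewrite R-full = unsettled
  ... | true with ε ≤ᵇ R
  ...   | false = unsettled
  ...   | true  = settled (full-after-settling f R≤C)

  amortized-slot : ∀ {o} → SlotOutcome o → ε + a * proj₂ o + potential (proj₁ o) ≤ C
  amortized-slot {w , _} unsettled = begin
    ε + a * 0ℚ + potential w   ≡⟨ cong (λ x → ε + x + potential w) (*-zeroʳ a) ⟩
    ε + 0ℚ + potential w       ≡⟨ cong (_+ potential w) (+-identityʳ ε) ⟩
    ε + potential w            ≤⟨ +-monoʳ-≤ ε (potential≤C-ε w) ⟩
    ε + (C - ε)                ≡⟨ ε+[C-ε]≡C ⟩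
    C                          ∎
    where open ≤-Reasoning
  amortized-slot {w , _} (settled not-full) rewrite not-full = subst (_≤ C) (sym (+-identityʳ _)) ε+aε≤C

  adversary : Policy → ℕ → WState → List ℚ
  adversary B zero    w = []
  adversary B (suc n) w = v ∷ adversary (B ∘ (v ∷_)) n (proj₁ (step C F w (B [ v ]) v))
    where v = nextTx w

  adversary-valid : ∀ B n w → ValidTx C (adversary B n w)
  adversary-valid B zero    w = []
  adversary-valid B (suc n) w = (<⇒≤ (0<nextTx w) , nextTx≤C w) ∷ adversary-valid _ n _

  adversary-amortized : ∀ n B w → Bounded w →
    n × ε + a * runPolicy C F B w (adversary B n w) ≤ sumℚ (adversary B n w) + potential w
  adversary-amortized zero B w _ = begin
    0ℚ + a * 0ℚ        ≡⟨ cong (0ℚ +_) (*-zeroʳ a) ⟩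
    0ℚ + 0ℚ            ≤⟨ +-monoʳ-≤ 0ℚ (0≤potential w) ⟩
    0ℚ + potential w   ∎
    where open ≤-Reasoning
  adversary-amortized (suc n) B w w-bounded = begin
    (ε + n × ε) + a * runPolicy C F B w (v ∷ rest)      ≡⟨ cong (λ x → (ε + n × ε) + a * x) (runPolicy-∷ C F B w v rest) ⟩
    (ε + n × ε) + a * (g + runPolicy C F B′ w′ rest)    ≡⟨ solve 5 (λ e m a g r → (e :+ m) :+ a :* (g :+ r) := (e :+ a :* g) :+ (m :+ a :* r))
                                                              refl ε (n × ε) a g (runPolicy C F B′ w′ rest) ⟩
    (ε + a * g) + (n × ε + a * runPolicy C F B′ w′ rest) ≤⟨ +-monoʳ-≤ (ε + a * g) (adversary-amortized n B′ w′ w′-bounded) ⟩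
    (ε + a * g) + (sumℚ rest + potential w′)             ≡⟨ solve 3 (λ x s p → x :+ (s :+ p) := (x :+ p) :+ s) refl (ε + a * g) (sumℚ rest) (potential w′) ⟩
    (ε + a * g + potential w′) + sumℚ rest               ≤⟨ +-monoˡ-≤ (sumℚ rest) (amortized-slot (step-outcome w (B [ v ]) w-bounded)) ⟩
    C + sumℚ rest                                        ≡⟨ cong (_+ sumℚ rest) (sym (nextTx+potential≡C w)) ⟩
    (v + potential w) + sumℚ rest                        ≡⟨ solve 3 (λ x p s → (x :+ p) :+ s := (x :+ s) :+ p) refl v (potential w) (sumℚ rest) ⟩
    (v + sumℚ rest) + potential w                        ∎
    where
    open ≤-Reasoning
    v : ℚ
    v = nextTx w
    B′ : Policy
    B′ = B ∘ (v ∷_)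
    w′ : WState
    w′ = proj₁ (step C F w (B [ v ]) v)
    g : ℚ
    g = proj₂ (step C F w (B [ v ]) v)
    rest : List ℚ
    rest = adversary B′ n w′
    w′-bounded : Bounded w′
    w′-bounded = step-bounded w (B [ v ]) (0<nextTx w) w-bounded

competitive⇒multiples-bounded :
  ∀ {C α c ε} F′ A → 0ℚ < ε → ε ≤ C → ε + (suc (suc F′) × α) * ε ≤ C →
  (∀ tx → ValidTx C tx → VOPT C (suc F′) tx ≤ α * V C (suc F′) A tx + c) →
  ∀ n → n × ε ≤ suc (suc F′) × c + (C - ε)
competitive⇒multiples-bounded {C} {α} {c} {ε} F′ A 0<ε ε≤C ε+aε≤C competitive n =
  +-cancelʳ-≤ (a * V C F A tx) (begin
    n × ε + a * V C F A tx                   ≤⟨ adversary-amortized n A (online C) ≤-refl ⟩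
    sumℚ tx + potential (online C)           ≤⟨ +-monoʳ-≤ (sumℚ tx) (potential≤C-ε (online C)) ⟩
    sumℚ tx + (C - ε)                        ≤⟨ +-monoˡ-≤ (C - ε) (sumℚ-≤-VOPT (All.map proj₂ tx-valid)) ⟩
    P × VOPT C F tx + (C - ε)                ≤⟨ +-monoˡ-≤ (C - ε) (×-monoʳ-≤ P (competitive tx tx-valid)) ⟩
    P × (α * V C F A tx + c) + (C - ε)       ≡⟨ cong (_+ (C - ε)) P×[αV+c]≡aV+P×c ⟩
    a * V C F A tx + P × c + (C - ε)         ≡⟨ solve 3 (λ x y z → x :+ y :+ z := y :+ z :+ x) refl (a * V C F A tx) (P × c) (C - ε) ⟩
    P × c + (C - ε) + a * V C F A tx         ∎)
  where
  open ≤-Reasoning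
  F P : ℕ
  F = suc F′
  P = suc F
  a : ℚ
  a = P × α
  open SettleAndFlush C F′ using (sumℚ-≤-VOPT)
  open Adversary C ε a F 0<ε ε≤C ε+aε≤C
  tx : List ℚ
  tx = adversary A n (online C)
  tx-valid : ValidTx C tx
  tx-valid = adversary-valid A n (online C)
  P×[αV+c]≡aV+P×c : P × (α * V C F A tx + c) ≡ a * V C F A tx + P × c
  P×[αV+c]≡aV+P×c = trans (×-distrib-+ (α * V C F A tx) c P) (cong (_+ P × c) (sym (×-assoc-* P α (V C F A tx))))

module _ (C a : ℚ) .{{_ : Positive C}} where

  private
    D : ℚ
    D = 1ℚ + (a ⊔ 0ℚ)

    1≤D : 1ℚ ≤ D
    1≤D = subst (_≤ D) (+-identityʳ 1ℚ) (+-monoʳ-≤ 1ℚ (p≤q⊔p a 0ℚ))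

    instance
      D>0 : Positive D
      D>0 = positive (<-≤-trans (positive⁻¹ 1ℚ) 1≤D)
      D≢0 : NonZero D
      D≢0 = pos⇒nonZero D

  smallTx : ℚ
  smallTx = C * 1/ D

  smallTx-positive : Positive smallTx
  smallTx-positive = pos*pos⇒pos C (1/ D) {{1/pos⇒pos D}}

  private
    instance
      smallTx≥0 : NonNegative smallTx
      smallTx≥0 = pos⇒nonNeg smallTx {{smallTx-positive}}

    smallTx*D≡C : smallTx * D ≡ C
    smallTx*D≡C = trans (*-assoc C (1/ D) D) (trans (cong (C *_) (*-inverseˡ D)) (*-identityʳ C))

  smallTx≤C : smallTx ≤ C
  smallTx≤C = subst₂ _≤_ (*-identityʳ smallTx) smallTx*D≡C (*-monoˡ-≤-nonNeg smallTx 1≤D)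

  smallTx+a*smallTx≤C : smallTx + a * smallTx ≤ C
  smallTx+a*smallTx≤C = subst₂ _≤_ (solve 2 (λ e a → e :* (con 1ℚ :+ a) := e :+ a :* e) refl smallTx a) smallTx*D≡C
    (*-monoˡ-≤-nonNeg smallTx (+-monoʳ-≤ 1ℚ (p≤p⊔q a 0ℚ)))

theorem3 : (C : ℚ) → 0ℚ < C → (F : ℕ) → F ≥ 1 →
    (A : Policy) → (α : ℚ) → ¬ Competitive C C F A α
theorem3 C 0<C (suc F′) (ℕ.s≤s ℕ.z≤n) A α (c , competitive) =
  let n , X<n×ε = archimedean ε X in
  <-irrefl refl (<-≤-trans X<n×ε
    (competitive⇒multiples-bounded {α = α} {c = c} F′ A (positive⁻¹ ε) (smallTx≤C C a) (smallTx+a*smallTx≤C C a) competitive n))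
  where
  instance
    C>0 : Positive C
    C>0 = positive 0<C
  a : ℚ
  a = suc (suc F′) × α
  ε : ℚ
  ε = smallTx C a
  instance
    ε>0 : Positive ε
    ε>0 = smallTx-positive C a
  X : ℚ
  X = suc (suc F′) × c + (C - ε)
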